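{- $\mathsf{KFLU}\vdash\mathrm C(f)\to\forall x\,[\mathscr A^{\mathsf{LU}}(f,\mathrm P_{\mathsf lf}(\bullet),x)\to\mathrm P_{\mathsf lf}(x)]$.
   Context: $\mathcal L$ is the language of the applicative theory $\mathsf{TON}$ (constants $\mathsf{k},\mathsf{s},\mathsf{p},\mathsf{p}_0,\mathsf{p}_1,\mathsf{0},\mathsf{s}_\mathsf{N},\mathsf{p}_\mathsf{N},\mathsf{d}_\mathsf{N}$, application, predicate $\mathrm N$; combinator, pairing, number, numerical-cases axioms and induction on $\mathrm N$). $\mathcal L_{FS}$ adds constants $\dot=,\dot\neg,\dot\wedge,\dot\to,\dot\forall,\dot{\mathsf N},\mathsf l$ and predicates $\mathrm T,\mathrm U$. $\mathrm P(x):=\mathrm T(x)\vee\mathrm T(\dot\neg x)$, $\mathrm C(f):=\forall x\,\mathrm P(fx)$, $f\sqsubset g:=\forall x(\mathrm T(fx)\to\mathrm T(g(fx)))\wedge\forall x(\mathrm T(\dot\neg(fx))\to\mathrm T(g(\dot\neg(fx))))$, $\mathrm P_{\mathsf lf}(x):=\mathrm T(\mathsf lfx)\vee\mathrm T(\mathsf lf(\dot\neg x))$. $\mathscr A^{\mathsf{LU}}(f,B(\bullet),x)$ is the disjunction of: $\exists y,z(x=(y\dot=z)\wedge y=z)$; $\exists y(x=\dot{\mathsf N}y\wedge\mathrm N(y))$; $\exists y(x=\dot\neg y\wedge B(y))$; $\exists y,z(x=y\dot\wedge z\wedge\{[B(y)\wedge B(z)]\vee[B(y)\wedge\mathrm T(\mathsf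 lf(\dot\neg y))]\vee[B(z)\wedge\mathrm T(\mathsf lf(\dot\neg z))]\})$; $\exists y,z(x=y\dot\to z\wedge\{[B(y)\wedge B(z)]\vee[B(y)\wedge\mathrm T(\mathsf lf(\dot\neg y))]\vee[B(z)\wedge\mathrm T(\mathsf lfz)]\})$; $\exists g(x=\dot\forall g\wedge\{\forall y\,B(gy)\vee\exists y(B(gy)\wedge\mathrm T(\mathsf lf(\dot\neg(gy))))\})$; $\exists y(x=fy)$; $\exists g,y(x=\mathsf lgy\wedge\mathrm P_{\mathsf lf}(x))$. $\mathsf{KFLU}$: $\mathsf{TON}$ (induction for all $\mathcal L_{FS}$-formulas) plus, for $\mathrm U(u)$: $\mathrm T(u(x\dot=y))\leftrightarrow x=y$; $\mathrm T(u(\dot\neg(x\dot=y)))\leftrightarrow x\ne y$; $\mathrm T(u(\dot{\mathsf N}x))\leftrightarrow\mathrm N(x)$; $\mathrm T(u(\dot\neg(\dot{\mathsf N}x)))\leftrightarrow\neg\mathrm N(x)$; $\mathrm T(u(\dot\neg(\dot\neg x)))\leftrightarrow\mathrm T(ux)$; $\mathrm T(u(x\dot\wedge y))\leftrightarrow\mathrm T(ux)\wedge\mathrm T(uy)$; $\mathrm T(u(\dot\neg(x\dot\wedge y)))\leftrightarrow\mathrm T(u(\dot\neg x))\vee\mathrm T(u(\dot\neg y))$; $\mathrm T(u(x\dot\to y))\leftrightarrow\mathrm T(u(\dot\neg x))\vee\mathrm T(uy)$; $\mathrm T(u(\dot\neg(x\dot\to y)))\leftrightarrow\mathrm T(ux)\wedge\mathrm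 T(u(\dot\neg y))$; $\mathrm T(u(\dot\forall f))\leftrightarrow\forall x\,\mathrm T(u(fx))$; $\mathrm T(u(\dot\neg(\dot\forall f)))\leftrightarrow\exists x\,\mathrm T(u(\dot\neg(fx)))$; $\neg(\mathrm T(ux)\wedge\mathrm T(u(\dot\neg x)))$; $\mathrm C(u)$; $\mathrm T(ux)\to\mathrm T(x)$; $\mathrm C(f)\to\mathrm U(\mathsf lf)\wedge f\sqsubset\mathsf lf$; unique-decomposition axioms $(\mathsf{UG})$ for the constants $\dot=,\dot\neg,\dot\wedge,\dot\to,\dot\forall,\dot{\mathsf N},\mathsf l$; and $(\mathsf{LU})$: $[\mathrm C(f)\wedge\forall x(\mathscr A^{\mathsf{LU}}(f,B(\bullet),x)\to B(x))]\to\forall x(\mathrm P_{\mathsf lf}(x)\to B(x))$ for all $\mathcal L_{FS}$-formulas $B$. -}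

module Defs where

-- Deep embedding of the first-order language L_FS (classical logic with
-- equality, total application), the theory KFLU, and derivability in it.

open import Data.Nat using (ℕ; zero; suc)
open import Data.List using (List; []; _∷_; map)
open import Data.List.Membership.Propositional using (_∈_)
open import Relation.Binary.PropositionalEquality using (_≢_)

data Const : Set where
  cK cS cP cP0 cP1 c0 cSN cPN cDN : Const          -- L
  cEq cNeg cAnd cImp cAll cNat cL : Const          -- L_FS extras

data Tm : Set where
  var : ℕ → Tm
  con : Const → Tm
  _·_ : Tm → Tm → Tm

infixl 9 _·_

data Fm : Set where
  _≐_       : Tm → Tm → Fm
  Nₚ Tₚ Uₚ  : Tm → Fm
  ⊥'        : Fm
  _⇒_ _∧'_ _∨'_ : Fm → Fm → Fm
  ∀' ∃'     : Fm → Fm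

infix  7 _≐_
infixr 6 _∧'_
infixr 5 _∨'_
infixr 4 _⇒_

¬' : Fm → Fm
¬' φ = φ ⇒ ⊥'

_⇔_ : Fm → Fm → Fm
φ ⇔ ψ = (φ ⇒ ψ) ∧' (ψ ⇒ φ)
infix 3 _⇔_

Ren : Set
Ren = ℕ → ℕ

ext : Ren → Ren
ext ρ zero    = zero
ext ρ (suc n) = suc (ρ n)

renT : Ren → Tm → Tm
renT ρ (var n) = var (ρ n)
renT ρ (con c) = con c
renT ρ (t · u) = renT ρ t · renT ρ u

renF : Ren → Fm → Fm
renF ρ (t ≐ u)  = renT ρ t ≐ renT ρ u
renF ρ (Nₚ t)   = Nₚ (renT ρ t)
renF ρ (Tₚ t)   = Tₚ (renT ρ t)
renF ρ (Uₚ t)   = Uₚ (renT ρ t)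
renF ρ ⊥'       = ⊥'
renF ρ (φ ⇒ ψ)  = renF ρ φ ⇒ renF ρ ψ
renF ρ (φ ∧' ψ) = renF ρ φ ∧' renF ρ ψ
renF ρ (φ ∨' ψ) = renF ρ φ ∨' renF ρ ψ
renF ρ (∀' φ)   = ∀' (renF (ext ρ) φ)
renF ρ (∃' φ)   = ∃' (renF (ext ρ) φ)

Sub : Set
Sub = ℕ → Tm

exts : Sub → Sub
exts σ zero    = var zero
exts σ (suc n) = renT suc (σ n)

subT : Sub → Tm → Tm
subT σ (var n) = σ n
subT σ (con c) = con c
subT σ (t · u) = subT σ t · subT σ u

subF : Sub → Fm → Fm
subF σ (t ≐ u)  = subT σ t ≐ subT σ u
subF σ (Nₚ t)   = Nₚ (subT σ t)
subF σ (Tₚ t)   = Tₚ (subT σ t)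
subF σ (Uₚ t)   = Uₚ (subT σ t)
subF σ ⊥'       = ⊥'
subF σ (φ ⇒ ψ)  = subF σ φ ⇒ subF σ ψ
subF σ (φ ∧' ψ) = subF σ φ ∧' subF σ ψ
subF σ (φ ∨' ψ) = subF σ φ ∨' subF σ ψ
subF σ (∀' φ)   = ∀' (subF (exts σ) φ)
subF σ (∃' φ)   = ∃' (subF (exts σ) φ)

wk : Tm → Tm
wk = renT suc

wkF : Fm → Fm
wkF = renF suc

-- A "predicate" B(•) is a formula whose variable 0 is the hole and whose
-- variable (i+1) is variable i of the ambient context.
-- B ⟪ t ⟫ : plug t into the hole.
_⟪_⟫ : Fm → Tm → Fm
B ⟪ t ⟫ = subF σ B
  where
  σ : Sub
  σ zero    = t
  σ (suc n) = var n

-- move a predicate under one more binder of the ambient context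
wkP : Fm → Fm
wkP = renF (ext suc)

v0 v1 v2 v3 : Tm
v0 = var 0
v1 = var 1
v2 = var 2
v3 = var 3

_≐̇_ _∧̇_ _→̇_ : Tm → Tm → Tm
x ≐̇ y = con cEq · x · y
x ∧̇ y = con cAnd · x · y
x →̇ y = con cImp · x · y

¬̇ ∀̇ Ṅ l̇ : Tm → Tm
¬̇ x = con cNeg · x
∀̇ x = con cAll · x
Ṅ x = con cNat · x
l̇ f = con cL · f

Pₐ : Tm → Fm
Pₐ x = Tₚ x ∨' Tₚ (¬̇ x)

Cₐ : Tm → Fm
Cₐ f = ∀' (Pₐ (wk f · v0))

_⊏_ : Tm → Tm → Fm
f ⊏ g = ∀' (Tₚ (wk f · v0) ⇒ Tₚ (wk g · (wk f · v0)))
     ∧' ∀' (Tₚ (¬̇ (wk f · v0)) ⇒ Tₚ (wk g · ¬̇ (wk f · v0)))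

Pl : Tm → Tm → Fm
Pl f x = Tₚ (l̇ f · x) ∨' Tₚ (l̇ f · ¬̇ x)

𝒜LU : Tm → Fm → Tm → Fm
𝒜LU f B x =
       ∃' (∃' (x₂ ≐ (v1 ≐̇ v0) ∧' v1 ≐ v0))
    ∨' ∃' (x₁ ≐ Ṅ v0 ∧' Nₚ v0)
    ∨' ∃' (x₁ ≐ ¬̇ v0 ∧' B₁ ⟪ v0 ⟫)
    ∨' ∃' (∃' (x₂ ≐ (v1 ∧̇ v0) ∧'
            ((B₂ ⟪ v1 ⟫ ∧' B₂ ⟪ v0 ⟫)
          ∨' (B₂ ⟪ v1 ⟫ ∧' Tₚ (l̇ f₂ · ¬̇ v1))
          ∨' (B₂ ⟪ v0 ⟫ ∧' Tₚ (l̇ f₂ · ¬̇ v0)))))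
    ∨' ∃' (∃' (x₂ ≐ (v1 →̇ v0) ∧'
            ((B₂ ⟪ v1 ⟫ ∧' B₂ ⟪ v0 ⟫)
          ∨' (B₂ ⟪ v1 ⟫ ∧' Tₚ (l̇ f₂ · ¬̇ v1))
          ∨' (B₂ ⟪ v0 ⟫ ∧' Tₚ (l̇ f₂ · v0)))))
    ∨' ∃' (x₁ ≐ ∀̇ v0 ∧'
            (∀' (B₂ ⟪ v1 · v0 ⟫)
          ∨' ∃' (B₂ ⟪ v1 · v0 ⟫ ∧' Tₚ (l̇ f₂ · ¬̇ (v1 · v0)))))
    ∨' ∃' (x₁ ≐ f₁ · v0)
    ∨' ∃' (∃' (x₂ ≐ l̇ v1 · v0 ∧' Pl f₂ x₂))
  where
  x₁ = wk x
  x₂ = wk (wk x)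
  f₁ = wk f
  f₂ = wk (wk f)
  B₁ = wkP B
  B₂ = wkP (wkP B)

-- Axioms of KFLU (as open formulas; all substitution instances are
-- available in the calculus, so they act as their universal closures)

-- syntactic constructors covered by (UG); unary ones ignore 2nd argument
data CodeC : Set where
  gEq gNeg gAnd gImp gAll gNat gL : CodeC

mk : CodeC → Tm → Tm → Tm
mk gEq  x y = x ≐̇ y
mk gNeg x y = ¬̇ x
mk gAnd x y = x ∧̇ y
mk gImp x y = x →̇ y
mk gAll x y = ∀̇ x
mk gNat x y = Ṅ x
mk gL   x y = con cL · x · y

injC : CodeC → Fm
injC gEq  = v0 ≐ v2 ∧' v1 ≐ v3
injC gNeg = v0 ≐ v2
injC gAnd = v0 ≐ v2 ∧' v1 ≐ v3
injC gImp = v0 ≐ v2 ∧' v1 ≐ v3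
injC gAll = v0 ≐ v2
injC gNat = v0 ≐ v2
injC gL   = v0 ≐ v2 ∧' v1 ≐ v3

0̇ : Tm
0̇ = con c0

sN pN : Tm → Tm
sN x = con cSN · x
pN x = con cPN · x

data KFLU : Fm → Set where
  axK   : KFLU (con cK · v0 · v1 ≐ v0)
  axS   : KFLU (con cS · v0 · v1 · v2 ≐ v0 · v2 · (v1 · v2))
  axP0  : KFLU (con cP0 · (con cP · v0 · v1) ≐ v0)
  axP1  : KFLU (con cP1 · (con cP · v0 · v1) ≐ v1)
  axN0  : KFLU (Nₚ 0̇)
  axNs  : KFLU (Nₚ v0 ⇒ Nₚ (sN v0))
  axNs0 : KFLU (Nₚ v0 ⇒ ¬' (sN v0 ≐ 0̇))
  axNps : KFLU (Nₚ v0 ⇒ pN (sN v0) ≐ v0)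
  axNp  : KFLU (Nₚ v0 ∧' ¬' (v0 ≐ 0̇) ⇒ Nₚ (pN v0) ∧' sN (pN v0) ≐ v0)
  axD1  : KFLU (Nₚ v2 ∧' Nₚ v3 ∧' v2 ≐ v3 ⇒ con cDN · v0 · v1 · v2 · v3 ≐ v0)
  axD2  : KFLU (Nₚ v2 ∧' Nₚ v3 ∧' ¬' (v2 ≐ v3) ⇒ con cDN · v0 · v1 · v2 · v3 ≐ v1)
  axInd : (B : Fm) → KFLU ((B ⟪ 0̇ ⟫ ∧' ∀' (Nₚ v0 ∧' wkP B ⟪ v0 ⟫ ⇒ wkP B ⟪ sN v0 ⟫))
                             ⇒ ∀' (Nₚ v0 ⇒ wkP B ⟪ v0 ⟫))
  -- KF-axioms for U(u); u = v0
  axUeq   : KFLU (Uₚ v0 ⇒ (Tₚ (v0 · (v1 ≐̇ v2)) ⇔ v1 ≐ v2))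
  axUneq  : KFLU (Uₚ v0 ⇒ (Tₚ (v0 · ¬̇ (v1 ≐̇ v2)) ⇔ ¬' (v1 ≐ v2)))
  axUN    : KFLU (Uₚ v0 ⇒ (Tₚ (v0 · Ṅ v1) ⇔ Nₚ v1))
  axUnN   : KFLU (Uₚ v0 ⇒ (Tₚ (v0 · ¬̇ (Ṅ v1)) ⇔ ¬' (Nₚ v1)))
  axUnn   : KFLU (Uₚ v0 ⇒ (Tₚ (v0 · ¬̇ (¬̇ v1)) ⇔ Tₚ (v0 · v1)))
  axUand  : KFLU (Uₚ v0 ⇒ (Tₚ (v0 · (v1 ∧̇ v2)) ⇔ Tₚ (v0 · v1) ∧' Tₚ (v0 · v2)))
  axUnand : KFLU (Uₚ v0 ⇒ (Tₚ (v0 · ¬̇ (v1 ∧̇ v2)) ⇔ Tₚ (v0 · ¬̇ v1) ∨' Tₚ (v0 · ¬̇ v2)))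
  axUimp  : KFLU (Uₚ v0 ⇒ (Tₚ (v0 · (v1 →̇ v2)) ⇔ Tₚ (v0 · ¬̇ v1) ∨' Tₚ (v0 · v2)))
  axUnimp : KFLU (Uₚ v0 ⇒ (Tₚ (v0 · ¬̇ (v1 →̇ v2)) ⇔ Tₚ (v0 · v1) ∧' Tₚ (v0 · ¬̇ v2)))
  -- u = v0, f = v1; inside ∀x: x = v0, u = v1, f = v2
  axUall  : KFLU (Uₚ v0 ⇒ (Tₚ (v0 · ∀̇ v1) ⇔ ∀' (Tₚ (v1 · (v2 · v0)))))
  axUnall : KFLU (Uₚ v0 ⇒ (Tₚ (v0 · ¬̇ (∀̇ v1)) ⇔ ∃' (Tₚ (v1 · ¬̇ (v2 · v0)))))
  axUcons : KFLU (Uₚ v0 ⇒ ¬' (Tₚ (v0 · v1) ∧' Tₚ (v0 · ¬̇ v1)))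
  axUC    : KFLU (Uₚ v0 ⇒ Cₐ v0)
  axUT    : KFLU (Uₚ v0 ⇒ (Tₚ (v0 · v1) ⇒ Tₚ v1))
  axL     : KFLU (Cₐ v0 ⇒ Uₚ (l̇ v0) ∧' (v0 ⊏ l̇ v0))
  -- (UG) unique decomposition: injectivity and disjointness of ranges
  axUGinj  : (c : CodeC) → KFLU (mk c v0 v1 ≐ mk c v2 v3 ⇒ injC c)
  axUGdisj : (c d : CodeC) → c ≢ d → KFLU (¬' (mk c v0 v1 ≐ mk d v2 v3))
  -- (LU), f = v0, for all formulas B(•) (with parameters; B's variable 1 is f)
  axLU  : (B : Fm) → KFLU ((Cₐ v0 ∧' ∀' (𝒜LU v1 (wkP B) v0 ⇒ wkP B ⟪ v0 ⟫))
                            ⇒ ∀' (Pl v1 v0 ⇒ wkP B ⟪ v0 ⟫))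

infix 2 _⊢_
data _⊢_ (Γ : List Fm) : Fm → Set where
  hyp  : ∀ {φ} → φ ∈ Γ → Γ ⊢ φ
  ax   : ∀ {φ} → KFLU φ → (σ : Sub) → Γ ⊢ subF σ φ
  ⇒I   : ∀ {φ ψ} → (φ ∷ Γ) ⊢ ψ → Γ ⊢ φ ⇒ ψ
  ⇒E   : ∀ {φ ψ} → Γ ⊢ φ ⇒ ψ → Γ ⊢ φ → Γ ⊢ ψ
  ∧I   : ∀ {φ ψ} → Γ ⊢ φ → Γ ⊢ ψ → Γ ⊢ φ ∧' ψ
  ∧E₁  : ∀ {φ ψ} → Γ ⊢ φ ∧' ψ → Γ ⊢ φ
  ∧E₂  : ∀ {φ ψ} → Γ ⊢ φ ∧' ψ → Γ ⊢ ψ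
  ∨I₁  : ∀ {φ ψ} → Γ ⊢ φ → Γ ⊢ φ ∨' ψ
  ∨I₂  : ∀ {φ ψ} → Γ ⊢ ψ → Γ ⊢ φ ∨' ψ
  ∨E   : ∀ {φ ψ χ} → Γ ⊢ φ ∨' ψ → (φ ∷ Γ) ⊢ χ → (ψ ∷ Γ) ⊢ χ → Γ ⊢ χ
  raa  : ∀ {φ} → (¬' φ ∷ Γ) ⊢ ⊥' → Γ ⊢ φ
  ∀I   : ∀ {φ} → map wkF Γ ⊢ φ → Γ ⊢ ∀' φ
  ∀E   : ∀ {φ} → Γ ⊢ ∀' φ → (t : Tm) → Γ ⊢ φ ⟪ t ⟫
  ∃I   : ∀ {φ} (t : Tm) → Γ ⊢ φ ⟪ t ⟫ → Γ ⊢ ∃' φ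
  ∃E   : ∀ {φ ψ} → Γ ⊢ ∃' φ → (φ ∷ map wkF Γ) ⊢ wkF ψ → Γ ⊢ ψ
  ≐refl : ∀ {t} → Γ ⊢ t ≐ t
  ≐E   : ∀ {φ s t} → Γ ⊢ s ≐ t → Γ ⊢ φ ⟪ s ⟫ → Γ ⊢ φ ⟪ t ⟫

KFLU⊢ : Fm → Set
KFLU⊢ φ = [] ⊢ φ

-- The sentence of Corollary 6.2 (universal closure over f):
--   ∀f ( C(f) → ∀x [ 𝒜^LU(f, P_{lf}(•), x) → P_{lf}(x) ] )
-- inside ∀f ∀x : x = v0, f = v1; the predicate P_{lf}(•) has hole v0,
-- x = v1, f = v2.
cor62-sentence : Fm
cor62-sentence = ∀' (Cₐ v0 ⇒ ∀' (𝒜LU v1 (Pl v2 v0) v0 ⇒ Pl v1 v0))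

{-# OPTIONS --safe #-}
-- Since C(f), axiom (L) makes lf a truth predicate (U(lf)) extending f. Each clause of
-- 𝒜^LU then yields P_lf(x) through the matching compositional axiom for U(lf), used
-- from right to left; values fy are decided because f is complete and f ⊏ lf. The only
-- classical step is in the ∀̇ clause, where ∀y (T(lf(gy)) ∨ T(lf(¬̇(gy)))) is split into
-- ∀y T(lf(gy)) ∨ ∃y T(lf(¬̇(gy))).
module Submission where

open import Defs
open import Function using (_∘_)
open import Data.Nat using (zero; suc)
open import Data.List using (List; []; _∷_; map)
open import Data.List.Relation.Unary.Any using (here; there)
open import Data.List.Relation.Binary.Subset.Propositional using (_⊆_)
open import Data.List.Relation.Binary.Subset.Propositional.Properties using (map⁺; ∷⁺ʳ)
open import Relation.Binary.PropositionalEquality using (_≡_; _≗_; refl; sym; cong; cong₂; subst)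

private
  variable
    Γ Δ : List Fm
    φ ψ χ θ γ : Fm
    s t u f g x y z : Tm

exts-ext-cancel : ∀ {ρ : Ren} {σ : Sub} → σ ∘ ρ ≗ var → ∀ n → exts σ (ext ρ n) ≡ var n
exts-ext-cancel σρ≗var zero    = refl
exts-ext-cancel σρ≗var (suc n) = cong wk (σρ≗var n)

subT-renT-cancel : ∀ {ρ : Ren} {σ : Sub} → σ ∘ ρ ≗ var → ∀ t → subT σ (renT ρ t) ≡ t
subT-renT-cancel σρ≗var (var n) = σρ≗var n
subT-renT-cancel σρ≗var (con c) = refl
subT-renT-cancel σρ≗var (t · u) = cong₂ _·_ (subT-renT-cancel σρ≗var t) (subT-renT-cancel σρ≗var u)

subF-renF-cancel : ∀ {ρ : Ren} {σ : Sub} → σ ∘ ρ ≗ var → ∀ φ → subF σ (renF ρ φ) ≡ φ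
subF-renF-cancel σρ≗var (t ≐ u)  = cong₂ _≐_ (subT-renT-cancel σρ≗var t) (subT-renT-cancel σρ≗var u)
subF-renF-cancel σρ≗var (Nₚ t)   = cong Nₚ (subT-renT-cancel σρ≗var t)
subF-renF-cancel σρ≗var (Tₚ t)   = cong Tₚ (subT-renT-cancel σρ≗var t)
subF-renF-cancel σρ≗var (Uₚ t)   = cong Uₚ (subT-renT-cancel σρ≗var t)
subF-renF-cancel σρ≗var ⊥'       = refl
subF-renF-cancel σρ≗var (φ ⇒ ψ)  = cong₂ _⇒_ (subF-renF-cancel σρ≗var φ) (subF-renF-cancel σρ≗var ψ)
subF-renF-cancel σρ≗var (φ ∧' ψ) = cong₂ _∧'_ (subF-renF-cancel σρ≗var φ) (subF-renF-cancel σρ≗var ψ)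
subF-renF-cancel σρ≗var (φ ∨' ψ) = cong₂ _∨'_ (subF-renF-cancel σρ≗var φ) (subF-renF-cancel σρ≗var ψ)
subF-renF-cancel σρ≗var (∀' φ)   = cong ∀' (subF-renF-cancel (exts-ext-cancel σρ≗var) φ)
subF-renF-cancel σρ≗var (∃' φ)   = cong ∃' (subF-renF-cancel (exts-ext-cancel σρ≗var) φ)

-- The substitution hidden in φ ⟪ t ⟫ sends suc n to var n, so it cancels a weakening;
-- Agda infers it from the goal wherever the cancellation lemmas are applied below.
wkP-⟪v0⟫ : ∀ φ → wkP φ ⟪ v0 ⟫ ≡ φ
wkP-⟪v0⟫ φ = subF-renF-cancel (λ { zero → refl ; (suc n) → refl }) φ

weaken : Γ ⊆ Δ → Γ ⊢ φ → Δ ⊢ φ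
weaken Γ⊆Δ (hyp φ∈Γ) = hyp (Γ⊆Δ φ∈Γ)
weaken Γ⊆Δ (ax a σ)  = ax a σ
weaken Γ⊆Δ (⇒I d)    = ⇒I (weaken (∷⁺ʳ _ Γ⊆Δ) d)
weaken Γ⊆Δ (⇒E d e)  = ⇒E (weaken Γ⊆Δ d) (weaken Γ⊆Δ e)
weaken Γ⊆Δ (∧I d e)  = ∧I (weaken Γ⊆Δ d) (weaken Γ⊆Δ e)
weaken Γ⊆Δ (∧E₁ d)   = ∧E₁ (weaken Γ⊆Δ d)
weaken Γ⊆Δ (∧E₂ d)   = ∧E₂ (weaken Γ⊆Δ d)
weaken Γ⊆Δ (∨I₁ d)   = ∨I₁ (weaken Γ⊆Δ d)
weaken Γ⊆Δ (∨I₂ d)   = ∨I₂ (weaken Γ⊆Δ d)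
weaken Γ⊆Δ (∨E d e g) = ∨E (weaken Γ⊆Δ d) (weaken (∷⁺ʳ _ Γ⊆Δ) e) (weaken (∷⁺ʳ _ Γ⊆Δ) g)
weaken Γ⊆Δ (raa d)   = raa (weaken (∷⁺ʳ _ Γ⊆Δ) d)
weaken Γ⊆Δ (∀I d)    = ∀I (weaken (map⁺ wkF Γ⊆Δ) d)
weaken Γ⊆Δ (∀E d t)  = ∀E (weaken Γ⊆Δ d) t
weaken Γ⊆Δ (∃I t d)  = ∃I t (weaken Γ⊆Δ d)
weaken Γ⊆Δ (∃E d e)  = ∃E (weaken Γ⊆Δ d) (weaken (∷⁺ʳ _ (map⁺ wkF Γ⊆Δ)) e)
weaken Γ⊆Δ ≐refl     = ≐refl
weaken Γ⊆Δ (≐E e d)  = ≐E (weaken Γ⊆Δ e) (weaken Γ⊆Δ d)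

↑ : Γ ⊢ φ → (ψ ∷ Γ) ⊢ φ
↑ = weaken there

#0 : (φ ∷ Γ) ⊢ φ
#0 = hyp (here refl)

#1 : (ψ ∷ φ ∷ Γ) ⊢ φ
#1 = ↑ #0

#2 : (χ ∷ ψ ∷ φ ∷ Γ) ⊢ φ
#2 = ↑ #1

#3 : (θ ∷ χ ∷ ψ ∷ φ ∷ Γ) ⊢ φ
#3 = ↑ #2

cast : φ ≡ ψ → Γ ⊢ φ → Γ ⊢ ψ
cast {Γ = Γ} = subst (Γ ⊢_)

⇔-from : Γ ⊢ φ ⇔ ψ → Γ ⊢ ψ → Γ ⊢ φ
⇔-from φ⇔ψ = ⇒E (∧E₂ φ⇔ψ)

excluded-middle : ∀ φ → Γ ⊢ φ ∨' ¬' φ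
excluded-middle φ = raa (⇒E #0 (∨I₂ (⇒I (⇒E #1 (∨I₁ #0)))))

⇒∨-elim : Γ ⊢ γ ⇒ φ ⇒ χ → Γ ⊢ γ ⇒ ψ ⇒ χ → Γ ⊢ γ ⇒ φ ∨' ψ ⇒ χ
⇒∨-elim γ⇒φ⇒χ γ⇒ψ⇒χ =
  ⇒I (⇒I (∨E #0 (⇒E (⇒E (↑ (↑ (↑ γ⇒φ⇒χ))) #2) #0) (⇒E (⇒E (↑ (↑ (↑ γ⇒ψ⇒χ))) #2) #0)))

∃-∧-proj₂ : Γ ⊢ ∃' (φ ∧' ψ) → Γ ⊢ ∃' ψ
∃-∧-proj₂ {ψ = ψ} ∃φ∧ψ = ∃E ∃φ∧ψ (∃I v0 (cast (sym (wkP-⟪v0⟫ ψ)) (∧E₂ #0)))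

∀-∨-split : Γ ⊢ ∀' (φ ∨' ψ) ⇒ ∀' φ ∨' ∃' ψ
∀-∨-split {Γ = Γ} {φ = φ} {ψ = ψ} = ⇒I (∨E (excluded-middle (∃' ψ)) (∨I₂ #0) (∨I₁ (∀I φ-everywhere)))
  where
  φ∨ψ : map wkF (¬' (∃' ψ) ∷ ∀' (φ ∨' ψ) ∷ Γ) ⊢ φ ∨' ψ
  φ∨ψ = cast (cong₂ _∨'_ (wkP-⟪v0⟫ φ) (wkP-⟪v0⟫ ψ)) (∀E #1 v0)

  φ-everywhere : map wkF (¬' (∃' ψ) ∷ ∀' (φ ∨' ψ) ∷ Γ) ⊢ φ
  φ-everywhere = ∨E φ∨ψ #0 (raa (⇒E #2 (∃I v0 (cast (sym (wkP-⟪v0⟫ ψ)) #1))))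

≐-sym : Γ ⊢ s ≐ t → Γ ⊢ t ≐ s
≐-sym {s = s} {t = t} s≐t =
  cast (cong (t ≐_) (subT-renT-cancel (λ _ → refl) s))
    (≐E {φ = v0 ≐ wk s} s≐t (cast (cong (s ≐_) (sym (subT-renT-cancel (λ _ → refl) s))) ≐refl))

fromList : List Tm → Sub
fromList []       n       = var n
fromList (t ∷ ts) zero    = t
fromList (t ∷ ts) (suc n) = fromList ts n

from-U-axiom : KFLU (Uₚ v0 ⇒ (φ ⇔ ψ)) → ∀ ts → Γ ⊢ Uₚ u →
               Γ ⊢ subF (fromList (u ∷ ts)) ψ → Γ ⊢ subF (fromList (u ∷ ts)) φ
from-U-axiom {u = u} axiom ts U[u] = ⇔-from (⇒E (ax axiom (fromList (u ∷ ts))) U[u])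

U-l̇ : Γ ⊢ Cₐ f → Γ ⊢ Uₚ (l̇ f)
U-l̇ {f = f} C[f] = ∧E₁ (⇒E (ax axL (fromList (f ∷ []))) C[f])

⊏-l̇ : Γ ⊢ Cₐ f → Γ ⊢ f ⊏ l̇ f
⊏-l̇ {f = f} C[f] = ∧E₂ (⇒E (ax axL (fromList (f ∷ []))) C[f])

C-app : Γ ⊢ Cₐ f → Γ ⊢ Pₐ (f · y)
C-app {f = f} {y = y} C[f] = cast (cong (λ r → Pₐ (r · y)) (subT-renT-cancel (λ _ → refl) f)) (∀E C[f] y)

⊏-true : Γ ⊢ f ⊏ g → Γ ⊢ Tₚ (f · y) → Γ ⊢ Tₚ (g · (f · y))
⊏-true {f = f} {g = g} {y = y} f⊏g = ⇒E (cast instance-at-y (∀E (∧E₁ f⊏g) y))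
  where
  instance-at-y : (Tₚ (wk f · v0) ⇒ Tₚ (wk g · (wk f · v0))) ⟪ y ⟫ ≡ (Tₚ (f · y) ⇒ Tₚ (g · (f · y)))
  instance-at-y = cong₂ (λ r q → Tₚ (r · y) ⇒ Tₚ (q · (r · y)))
                        (subT-renT-cancel (λ _ → refl) f) (subT-renT-cancel (λ _ → refl) g)

⊏-false : Γ ⊢ f ⊏ g → Γ ⊢ Tₚ (¬̇ (f · y)) → Γ ⊢ Tₚ (g · ¬̇ (f · y))
⊏-false {f = f} {g = g} {y = y} f⊏g = ⇒E (cast instance-at-y (∀E (∧E₂ f⊏g) y))
  where
  instance-at-y : (Tₚ (¬̇ (wk f · v0)) ⇒ Tₚ (wk g · ¬̇ (wk f · v0))) ⟪ y ⟫
                ≡ (Tₚ (¬̇ (f · y)) ⇒ Tₚ (g · ¬̇ (f · y)))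
  instance-at-y = cong₂ (λ r q → Tₚ (¬̇ (r · y)) ⇒ Tₚ (q · ¬̇ (r · y)))
                        (subT-renT-cancel (λ _ → refl) f) (subT-renT-cancel (λ _ → refl) g)

-- The paper's P relative to u: Pl f x unfolds to Decided (l̇ f) x.
Decided : Tm → Tm → Fm
Decided u x = Tₚ (u · x) ∨' Tₚ (u · ¬̇ x)

decided-resp-≐ : Γ ⊢ x ≐ y → Γ ⊢ Decided u y → Γ ⊢ Decided u x
decided-resp-≐ {Γ = Γ} {x = x} {y = y} {u = u} x≐y D[y] =
  cast (plug x) (≐E {φ = Decided (wk u) v0} (≐-sym x≐y) (cast (sym (plug y)) D[y]))
  where
  plug : ∀ t → Decided (wk u) v0 ⟪ t ⟫ ≡ Decided u t
  plug t = cong (λ r → Decided r t) (subT-renT-cancel (λ _ → refl) u)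

decided-app : Γ ⊢ Cₐ f → Γ ⊢ Decided (l̇ f) (f · y)
decided-app C[f] = ∨E (C-app C[f]) (∨I₁ (⊏-true (⊏-l̇ (↑ C[f])) #0)) (∨I₂ (⊏-false (⊏-l̇ (↑ C[f])) #0))

decided-≐̇ : Γ ⊢ Uₚ u → Γ ⊢ y ≐ z → Γ ⊢ Decided u (y ≐̇ z)
decided-≐̇ {y = y} {z = z} U[u] y≐z = ∨I₁ (from-U-axiom axUeq (y ∷ z ∷ []) U[u] y≐z)

decided-Ṅ : Γ ⊢ Uₚ u → Γ ⊢ Nₚ y → Γ ⊢ Decided u (Ṅ y)
decided-Ṅ {y = y} U[u] N[y] = ∨I₁ (from-U-axiom axUN (y ∷ []) U[u] N[y])

decided-¬̇ : Γ ⊢ Uₚ u → Γ ⊢ Decided u y → Γ ⊢ Decided u (¬̇ y)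
decided-¬̇ {y = y} U[u] D[y] = ∨E D[y] (∨I₂ (from-U-axiom axUnn (y ∷ []) (↑ U[u]) #0)) (∨I₁ #0)

decided-∧̇-both : Γ ⊢ Uₚ u → Γ ⊢ Decided u y → Γ ⊢ Decided u z → Γ ⊢ Decided u (y ∧̇ z)
decided-∧̇-both {u = u} {y = y} {z = z} U[u] D[y] D[z] =
  ∨E D[y]
    (∨E (↑ D[z])
      (∨I₁ (from-U-axiom axUand (y ∷ z ∷ []) (↑ (↑ U[u])) (∧I #1 #0)))
      (∨I₂ (from-U-axiom axUnand (y ∷ z ∷ []) (↑ (↑ U[u])) (∨I₂ #0))))
    (∨I₂ (from-U-axiom axUnand (y ∷ z ∷ []) (↑ U[u]) (∨I₁ #0)))

decided-∧̇ : Γ ⊢ Uₚ u →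
            Γ ⊢ (Decided u y ∧' Decided u z) ∨' (Decided u y ∧' Tₚ (u · ¬̇ y))
                                             ∨' (Decided u z ∧' Tₚ (u · ¬̇ z)) →
            Γ ⊢ Decided u (y ∧̇ z)
decided-∧̇ {u = u} {y = y} {z = z} U[u] clause =
  ∨E clause
    (decided-∧̇-both (↑ U[u]) (∧E₁ #0) (∧E₂ #0))
    (∨E #0
      (∨I₂ (from-U-axiom axUnand (y ∷ z ∷ []) (↑ (↑ U[u])) (∨I₁ (∧E₂ #0))))
      (∨I₂ (from-U-axiom axUnand (y ∷ z ∷ []) (↑ (↑ U[u])) (∨I₂ (∧E₂ #0)))))

decided-→̇-both : Γ ⊢ Uₚ u → Γ ⊢ Decided u y → Γ ⊢ Decided u z → Γ ⊢ Decided u (y →̇ z)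
decided-→̇-both {u = u} {y = y} {z = z} U[u] D[y] D[z] =
  ∨E D[y]
    (∨E (↑ D[z])
      (∨I₁ (from-U-axiom axUimp (y ∷ z ∷ []) (↑ (↑ U[u])) (∨I₂ #0)))
      (∨I₂ (from-U-axiom axUnimp (y ∷ z ∷ []) (↑ (↑ U[u])) (∧I #1 #0))))
    (∨I₁ (from-U-axiom axUimp (y ∷ z ∷ []) (↑ U[u]) (∨I₁ #0)))

decided-→̇ : Γ ⊢ Uₚ u →
            Γ ⊢ (Decided u y ∧' Decided u z) ∨' (Decided u y ∧' Tₚ (u · ¬̇ y))
                                             ∨' (Decided u z ∧' Tₚ (u · z)) →
            Γ ⊢ Decided u (y →̇ z)
decided-→̇ {u = u} {y = y} {z = z} U[u] clause =
  ∨E clause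
    (decided-→̇-both (↑ U[u]) (∧E₁ #0) (∧E₂ #0))
    (∨E #0
      (∨I₁ (from-U-axiom axUimp (y ∷ z ∷ []) (↑ (↑ U[u])) (∨I₁ (∧E₂ #0))))
      (∨I₁ (from-U-axiom axUimp (y ∷ z ∷ []) (↑ (↑ U[u])) (∨I₂ (∧E₂ #0)))))

decided-∀̇ : Γ ⊢ Uₚ u →
            Γ ⊢ ∀' (Decided (wk u) (wk g · v0))
             ∨' ∃' (Decided (wk u) (wk g · v0) ∧' Tₚ (wk u · ¬̇ (wk g · v0))) →
            Γ ⊢ Decided u (∀̇ g)
decided-∀̇ {g = g} U[u] clause =
  ∨E clause
    (∨E (⇒E ∀-∨-split #0)
      (∨I₁ (from-U-axiom axUall (g ∷ []) (↑ (↑ U[u])) #0))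
      (∨I₂ (from-U-axiom axUnall (g ∷ []) (↑ (↑ U[u])) #0)))
    (∨I₂ (from-U-axiom axUnall (g ∷ []) (↑ U[u]) (∃-∧-proj₂ #0)))

-- The eight disjuncts of 𝒜LU v1 (Pl v2 v0) v0, i.e. f = v1 and x = v0, each binder
-- shifting these indices by one.
closed-≐̇ : Γ ⊢ Cₐ v1 ⇒ ∃' (∃' (v2 ≐ (v1 ≐̇ v0) ∧' v1 ≐ v0)) ⇒ Pl v1 v0
closed-≐̇ = ⇒I (⇒I (∃E #0 (∃E #0 (decided-resp-≐ (∧E₁ #0) (decided-≐̇ (U-l̇ #3) (∧E₂ #0))))))

closed-Ṅ : Γ ⊢ Cₐ v1 ⇒ ∃' (v1 ≐ Ṅ v0 ∧' Nₚ v0) ⇒ Pl v1 v0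
closed-Ṅ = ⇒I (⇒I (∃E #0 (decided-resp-≐ (∧E₁ #0) (decided-Ṅ (U-l̇ #2) (∧E₂ #0)))))

closed-¬̇ : Γ ⊢ Cₐ v1 ⇒ ∃' (v1 ≐ ¬̇ v0 ∧' Pl v2 v0) ⇒ Pl v1 v0
closed-¬̇ = ⇒I (⇒I (∃E #0 (decided-resp-≐ (∧E₁ #0) (decided-¬̇ (U-l̇ #2) (∧E₂ #0)))))

closed-∧̇ : Γ ⊢ Cₐ v1 ⇒ ∃' (∃' (v2 ≐ (v1 ∧̇ v0) ∧'
                          ((Pl v3 v1 ∧' Pl v3 v0)
                        ∨' (Pl v3 v1 ∧' Tₚ (l̇ v3 · ¬̇ v1))
                        ∨' (Pl v3 v0 ∧' Tₚ (l̇ v3 · ¬̇ v0))))) ⇒ Pl v1 v0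
closed-∧̇ = ⇒I (⇒I (∃E #0 (∃E #0 (decided-resp-≐ (∧E₁ #0) (decided-∧̇ (U-l̇ #3) (∧E₂ #0))))))

closed-→̇ : Γ ⊢ Cₐ v1 ⇒ ∃' (∃' (v2 ≐ (v1 →̇ v0) ∧'
                          ((Pl v3 v1 ∧' Pl v3 v0)
                        ∨' (Pl v3 v1 ∧' Tₚ (l̇ v3 · ¬̇ v1))
                        ∨' (Pl v3 v0 ∧' Tₚ (l̇ v3 · v0))))) ⇒ Pl v1 v0
closed-→̇ = ⇒I (⇒I (∃E #0 (∃E #0 (decided-resp-≐ (∧E₁ #0) (decided-→̇ (U-l̇ #3) (∧E₂ #0))))))

closed-∀̇ : Γ ⊢ Cₐ v1 ⇒ ∃' (v1 ≐ ∀̇ v0 ∧'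
                          (∀' (Pl v3 (v1 · v0))
                        ∨' ∃' (Pl v3 (v1 · v0) ∧' Tₚ (l̇ v3 · ¬̇ (v1 · v0))))) ⇒ Pl v1 v0
closed-∀̇ = ⇒I (⇒I (∃E #0 (decided-resp-≐ (∧E₁ #0) (decided-∀̇ (U-l̇ #2) (∧E₂ #0)))))

closed-app : Γ ⊢ Cₐ v1 ⇒ ∃' (v1 ≐ v2 · v0) ⇒ Pl v1 v0
closed-app = ⇒I (⇒I (∃E #0 (decided-resp-≐ #0 (decided-app #2))))

closed-l̇ : Γ ⊢ Cₐ v1 ⇒ ∃' (∃' (v2 ≐ l̇ v1 · v0 ∧' Pl v3 v2)) ⇒ Pl v1 v0
closed-l̇ = ⇒I (⇒I (∃E #0 (∃E #0 (∧E₂ #0))))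

Pl-closed-under-𝒜LU : Γ ⊢ Cₐ v1 ⇒ 𝒜LU v1 (Pl v2 v0) v0 ⇒ Pl v1 v0
Pl-closed-under-𝒜LU =
  ⇒∨-elim closed-≐̇ (⇒∨-elim closed-Ṅ (⇒∨-elim closed-¬̇ (⇒∨-elim closed-∧̇
    (⇒∨-elim closed-→̇ (⇒∨-elim closed-∀̇ (⇒∨-elim closed-app closed-l̇))))))

corollary6p2 : KFLU⊢ cor62-sentence
corollary6p2 = ∀I (⇒I (∀I (⇒I (⇒E (⇒E Pl-closed-under-𝒜LU #1) #0))))
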